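{- Let $G$ be a finite simple gem-free graph, let $\omega=\omega(G)$, let $A=\{v_1,\dots,v_\omega\}$ be a maximum clique of $G$, and let the sets $C_{i,j}$ ($1\le i<j\le\omega$) and $I_l$ ($1\le l\le\omega$) be defined as in the context. Let $i<j$ with $j\geq 3$. Then: (i) $\langle C_{i,j}\rangle$ is $P_4$-free (and hence perfect); (ii) for any $l\in\{1,\dots,\omega\}$, if $H$ is a connected component of $\langle C_{i,j}\rangle$ and some $a\in V(H)$ satisfies $av_l\in E(G)$, then $v_l$ is adjacent to every vertex of $H$; (iii) if $a\in C_{i,j}$ and $av_l\notin E(G)$ for some $l\in\{1,\dots,\omega\}$, then $a$ has no neighbour in $I_l$; (iv) if $H$ is a connected component of $\langle C_{i,j}\rangle$, then $\omega(H)\leq |A\setminus N_A(V(H))|$.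
   Context: The gem is $K_1+P_4$: a path on four vertices plus a vertex adjacent to all of them. $\langle S\rangle$ denotes the subgraph induced by $S$; $N(S)$ is the set of neighbours of vertices of $S$, and $N_A(S)=N(S)\cap A$. Let $L=\{(i,j):1\le i<j\le\omega\}$ with lexicographic order: $(i_1,j_1)<_L(i_2,j_2)$ iff $i_1<i_2$, or $i_1=i_2$ and $j_1<j_2$. For $(i,j)\in L$, $C_{i,j}=\{v\in V(G)\setminus A: v\notin N(v_i)\cup N(v_j)\}\setminus \bigcup_{(i',j')<_L(i,j)}C_{i',j'}$. For $1\le l\le\omega$, $I_l=\{v\in V(G)\setminus A: v \text{ is adjacent to every } a\in A\setminus\{v_l\}\}$. -}

module Defs where

open import Data.Nat using (ℕ; _≤_)
open import Data.Fin using (Fin; toℕ; _<_)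
open import Data.Fin.Subset using (Subset; _∈_; ∣_∣)
open import Data.Product using (_×_; Σ; ∃; ∃-syntax; _,_)
open import Data.Sum using (_⊎_)
open import Relation.Nullary using (¬_; Dec)
open import Relation.Binary.PropositionalEquality using (_≡_; _≢_)
open import Function.Bundles using (_⇔_)

record Graph : Set₁ where
  field
    n    : ℕ
    E    : Fin n → Fin n → Set
    E?   : ∀ u v → Dec (E u v)
    sym  : ∀ {u v} → E u v → E v u
    irr  : ∀ v → ¬ E v v

module _ (G : Graph) where
  open Graph G

  V : Set
  V = Fin n

  -- A clique of size k, given as a map Fin k → V whose distinct entries are adjacent
  -- (hence the map is injective, by irreflexivity).
  IsClique : (k : ℕ) → (Fin k → V) → Set
  IsClique k f = ∀ i j → i ≢ j → E (f i) (f j)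

  InducedP4 : V → V → V → V → Set
  InducedP4 a b c d =
    (a ≢ b × a ≢ c × a ≢ d × b ≢ c × b ≢ d × c ≢ d) ×
    (E a b × E b c × E c d) × (¬ E a c × ¬ E a d × ¬ E b d)

  GemFree : Set
  GemFree = ∀ u a b c d → InducedP4 a b c d →
    u ≢ a → u ≢ b → u ≢ c → u ≢ d →
    ¬ (E u a × E u b × E u c × E u d)

  P4FreeOn : (V → Set) → Set
  P4FreeOn S = ∀ a b c d → S a → S b → S c → S d → ¬ InducedP4 a b c d

  -- w lies in the connected component of ⟨S⟩ containing r
  data Reach (S : V → Set) (r : V) : V → Set where
    here : S r → Reach S r r
    step : ∀ {u w} → Reach S r u → S w → E u w → Reach S r w

  CliqueNumberOn≤ : (V → Set) → ℕ → Set
  CliqueNumberOn≤ S m = ∀ k (f : Fin k → V) → IsClique k f → (∀ i → S (f i)) → k ≤ m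

  -- Data attached to a maximum clique A = {v_1,…,v_ω}; indices are 0-based (Fin ω).
  module _ (ω : ℕ) (v : Fin ω → V) where

    NotInA : V → Set
    NotInA x = ∀ m → x ≢ v m

    D : Fin ω → Fin ω → V → Set
    D i j x = NotInA x × ¬ E x (v i) × ¬ E x (v j)

    _<L_ : (Fin ω × Fin ω) → (Fin ω × Fin ω) → Set
    (i₁ , j₁) <L (i₂ , j₂) = i₁ < i₂ ⊎ (i₁ ≡ i₂ × j₁ < j₂)

    -- C_{i,j} = D_{i,j} minus all earlier C_{i',j'}, i.e. x lies in D_{i,j} and
    -- in no D_{i',j'} with i' < j' and (i',j') <_L (i,j).
    C : Fin ω → Fin ω → V → Set
    C i j x = D i j x × (∀ i' j' → i' < j' → (i' , j') <L (i , j) → ¬ D i' j' x)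

    I : Fin ω → V → Set
    I l x = NotInA x × (∀ m → m ≢ l → E x (v m))

{-# OPTIONS --safe #-}
module Submission where

-- Since j ≥ 3 there is an index m₀ < j other than i, and the lexicographic minimality built
-- into C_{i,j} makes every vertex of C_{i,j} adjacent to v_{m₀}. A gem-free graph has no
-- induced P4 among the neighbours of one vertex, which gives (i); applied to the paths
-- b – a – v_l – v_i and a – b – v_t – v_l (with t ∈ {i, j} and a ≁ v_t) it gives (ii) and
-- (iii), using that a vertex of I_l misses v_l by maximality of A. For (iv), by (ii) a clique
-- of a component H together with N_A(V(H)) is a clique of G, so it has at most
-- ω − |N_A(V(H))| = |A ∖ N_A(V(H))| vertices.

open import Defs
open import Data.Bool using (true)
open import Data.Nat using (ℕ; zero; suc; _+_; _∸_; _≤_; z≤n; s≤s)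
open import Data.Nat.Properties using (1+n≰n; m+n≤o⇒m≤o∸n; module ≤-Reasoning)
open import Data.Fin using (Fin; toℕ; _<_; splitAt; zero; suc)
open import Data.Fin.Properties
  using (_≟_; <-cmp; <⇒≢; suc-injective; splitAt⁻¹-↑ˡ; splitAt⁻¹-↑ʳ)
open import Data.Fin.Subset using (Subset; _∈_; ∣_∣; inside; outside; ∁; _⊆_)
open import Data.Fin.Subset.Properties using (p⊆q⇒∣p∣≤∣q∣; ∣∁p∣≡n∸∣p∣; x∈∁p⇒x∉p)
open import Data.Vec using (_∷_; here; there; tabulate)
open import Data.Vec.Properties using (lookup∘tabulate; lookup⇒[]=; []=⇒lookup)
open import Data.Vec.Functional using (_++_) renaming (_∷_ to _◂_)
open import Data.Product using (_×_; ∃-syntax; _,_)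
open import Data.Sum using (inj₁; inj₂)
open import Data.Empty using (⊥)
open import Function using (_∘_)
open import Function.Bundles using (_⇔_; Equivalence)
open import Function.Definitions using (Injective)
open import Relation.Binary using (tri<; tri≈; tri>)
open import Relation.Nullary using (¬_; Dec; yes; no; does; contradiction)
open import Relation.Nullary.Decidable using (dec-true)
open import Relation.Unary using (Decidable)
open import Relation.Binary.PropositionalEquality
  using (_≡_; _≢_; refl; sym; trans; cong; ≢-sym)

∃<≢ : ∀ {n} (a b : Fin n) → 2 ≤ toℕ b → ∃[ m ] m < b × m ≢ a
∃<≢ zero    (suc (suc b)) (s≤s (s≤s _)) = suc zero , s≤s (s≤s z≤n) , λ ()
∃<≢ (suc a) (suc (suc b)) (s≤s (s≤s _)) = zero     , s≤s z≤n       , λ ()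

module _ {n} {P : Fin n → Set} (P? : Decidable P) where

  subset : Subset n
  subset = tabulate (does ∘ P?)

  ∈-subset⁺ : ∀ {x} → P x → x ∈ subset
  ∈-subset⁺ {x} px = lookup⇒[]= x subset (trans (lookup∘tabulate _ x) (dec-true (P? x) px))

  ∈-subset⁻ : ∀ {x} → x ∈ subset → P x
  ∈-subset⁻ {x} x∈ = witness (P? x) (trans (sym (lookup∘tabulate _ x)) ([]=⇒lookup x∈))
    where
    witness : (d : Dec (P x)) → does d ≡ true → P x
    witness (yes px) _  = px
    witness (no  _)  ()

enum : ∀ {n} (p : Subset n) → Fin ∣ p ∣ → Fin n
enum (inside  ∷ p) zero    = zero
enum (inside  ∷ p) (suc x) = suc (enum p x)
enum (outside ∷ p) x       = suc (enum p x)

enum-∈ : ∀ {n} (p : Subset n) x → enum p x ∈ p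
enum-∈ (inside  ∷ p) zero    = here
enum-∈ (inside  ∷ p) (suc x) = there (enum-∈ p x)
enum-∈ (outside ∷ p) x       = there (enum-∈ p x)

enum-injective : ∀ {n} (p : Subset n) → Injective _≡_ _≡_ (enum p)
enum-injective (inside  ∷ p) {zero}  {zero}  e = refl
enum-injective (inside  ∷ p) {suc x} {suc y} e = cong suc (enum-injective p (suc-injective e))
enum-injective (outside ∷ p) {x}     {y}     e = enum-injective p (suc-injective e)

module _ (G : Graph) where
  open Graph G renaming (sym to E-sym)

  adjacent⇒≢ : ∀ {a b} → E a b → a ≢ b
  adjacent⇒≢ {a} e refl = irr a e

  inducedP4 : ∀ {a b c d} → E a b → E b c → E c d →
    ¬ E a c → ¬ E a d → ¬ E b d → a ≢ c → a ≢ d → b ≢ d → InducedP4 G a b c d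
  inducedP4 ab bc cd ¬ac ¬ad ¬bd a≢c a≢d b≢d =
    (adjacent⇒≢ ab , a≢c , a≢d , adjacent⇒≢ bc , b≢d , adjacent⇒≢ cd) ,
    (ab , bc , cd) , (¬ac , ¬ad , ¬bd)

  GemFree⇒¬dominated-P4 : GemFree G → ∀ {u a b c d} → InducedP4 G a b c d →
    E u a → E u b → E u c → E u d → ⊥
  GemFree⇒¬dominated-P4 gem p ua ub uc ud =
    gem _ _ _ _ _ p (adjacent⇒≢ ua) (adjacent⇒≢ ub) (adjacent⇒≢ uc) (adjacent⇒≢ ud)
      (ua , ub , uc , ud)

  dominated⇒P4FreeOn : GemFree G → ∀ {S u} → (∀ {x} → S x → E u x) → P4FreeOn G S
  dominated⇒P4FreeOn gem u~S a b c d sa sb sc sd p =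
    GemFree⇒¬dominated-P4 gem p (u~S sa) (u~S sb) (u~S sc) (u~S sd)

  -- Otherwise b – a – y – w is an induced P4 dominated by u.
  GemFree⇒dominated-path-chord : GemFree G → ∀ {u a b y w} →
    E a b → E a y → E y w → ¬ E a w → ¬ E b w → b ≢ y → b ≢ w → a ≢ w →
    E u a → E u b → E u y → E u w → E b y
  GemFree⇒dominated-path-chord gem {b = b} {y} ab ay yw ¬aw ¬bw b≢y b≢w a≢w ua ub uy uw
    with E? b y
  ... | yes by = by
  ... | no ¬by = contradiction
    (inducedP4 (E-sym ab) ay yw ¬by ¬bw ¬aw b≢y b≢w a≢w) λ p →
    GemFree⇒¬dominated-P4 gem p ub ua uy uw

  Reach⇒∈ : ∀ {S r x} → Reach G S r x → S x
  Reach⇒∈ (here s)     = s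
  Reach⇒∈ (step _ s _) = s

  EdgeClosed : (S P : V G → Set) → Set
  EdgeClosed S P = ∀ {a b} → S a → S b → E a b → P a → P b

  Reach-preserves : ∀ {S P r x} → EdgeClosed S P → Reach G S r x → P r → P x
  Reach-preserves closed (here _)       pr = pr
  Reach-preserves closed (step ru sw e) pr =
    closed (Reach⇒∈ ru) sw e (Reach-preserves closed ru pr)

  Reach-reflects : ∀ {S P r x} → EdgeClosed S P → Reach G S r x → P x → P r
  Reach-reflects closed (here _)       px = px
  Reach-reflects closed (step ru sw e) pw =
    Reach-reflects closed ru (closed sw (Reach⇒∈ ru) (E-sym e) pw)

  IsClique-◂ : ∀ {k f b} → IsClique G k f → (∀ q → E b (f q)) → IsClique G (suc k) (b ◂ f)
  IsClique-◂ f-cl b~f zero    zero    0≢0 = contradiction refl 0≢0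
  IsClique-◂ f-cl b~f zero    (suc q) _   = b~f q
  IsClique-◂ f-cl b~f (suc p) zero    _   = E-sym (b~f p)
  IsClique-◂ f-cl b~f (suc p) (suc q) p≢q = f-cl p q (p≢q ∘ cong suc)

  IsClique-++ : ∀ {k m f g} → IsClique G k f → IsClique G m g → (∀ a b → E (f a) (g b)) →
    IsClique G (k + m) (f ++ g)
  IsClique-++ {k} f-cl g-cl f~g x y x≢y with splitAt k x in ex | splitAt k y in ey
  ... | inj₁ a | inj₁ b = f-cl a b λ { refl → x≢y (trans (sym (splitAt⁻¹-↑ˡ ex)) (splitAt⁻¹-↑ˡ ey)) }
  ... | inj₁ a | inj₂ b = f~g a b
  ... | inj₂ a | inj₁ b = E-sym (f~g b a)
  ... | inj₂ a | inj₂ b = g-cl a b λ { refl → x≢y (trans (sym (splitAt⁻¹-↑ʳ ex)) (splitAt⁻¹-↑ʳ ey)) }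

  IsClique-∘ : ∀ {k m f} {h : Fin m → Fin k} → IsClique G k f → Injective _≡_ _≡_ h →
    IsClique G m (f ∘ h)
  IsClique-∘ f-cl h-inj p q p≢q = f-cl _ _ (p≢q ∘ h-inj)

  module MaximumClique {ω} {v : Fin ω → V G} (v-cl : IsClique G ω v)
    (maximum : ∀ k (f : Fin k → V G) → IsClique G k f → k ≤ ω) where

    adjacent-all-but⇒≁ : ∀ {b l} → (∀ q → q ≢ l → E b (v q)) → ¬ E b (v l)
    adjacent-all-but⇒≁ {b} {l} b~A b~l = 1+n≰n (maximum _ _ (IsClique-◂ v-cl b~v))
      where
      b~v : ∀ q → E b (v q)
      b~v q with q ≟ l
      ... | yes refl = b~l
      ... | no  q≢l  = b~A q q≢l

    clique+common-neighbours≤ω : ∀ {k f} (T : Subset ω) → IsClique G k f →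
      (∀ a m → m ∈ T → E (f a) (v m)) → k + ∣ T ∣ ≤ ω
    clique+common-neighbours≤ω T f-cl f~T = maximum _ _
      (IsClique-++ f-cl (IsClique-∘ v-cl (enum-injective T)) λ a t → f~T a _ (enum-∈ T t))

module _ (G : Graph) {ω} (v : Fin ω → V G) {i j : Fin ω} where
  open Graph G

  -- A missing neighbour v_m would put x into the earlier set D_{min(m,i), max(m,i)}.
  C⇒adjacent-below : ∀ {x m} → C G ω v i j x → m < j → m ≢ i → E x (v m)
  C⇒adjacent-below {x} {m} ((x∉A , x≁i , _) , earlier) m<j m≢i with E? x (v m)
  ... | yes x~m = x~m
  ... | no  x≁m with <-cmp m i
  ...   | tri< m<i _   _   = contradiction (x∉A , x≁m , x≁i) (earlier m i m<i (inj₁ m<i))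
  ...   | tri≈ _   m≡i _   = contradiction m≡i m≢i
  ...   | tri> _   _   i<m = contradiction (x∉A , x≁i , x≁m) (earlier i m i<m (inj₂ (refl , m<j)))

module C-Properties (G : Graph) (gem : GemFree G) {ω} {v : Fin ω → V G}
  (v-cl : IsClique G ω v) (maximum : ∀ k (f : Fin k → V G) → IsClique G k f → k ≤ ω)
  {i j m₀ : Fin ω} (i<j : i < j) (m₀<j : m₀ < j) (m₀≢i : m₀ ≢ i) where

  open Graph G renaming (sym to E-sym)
  open MaximumClique G v-cl maximum

  Cᵢⱼ : V G → Set
  Cᵢⱼ = C G ω v i j

  C⇒∉A : ∀ {x} → Cᵢⱼ x → ∀ m → x ≢ v m
  C⇒∉A ((x∉A , _) , _) = x∉A

  C⇒≁vᵢ : ∀ {x} → Cᵢⱼ x → ¬ E x (v i)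
  C⇒≁vᵢ ((_ , x≁i , _) , _) = x≁i

  C⇒≁vⱼ : ∀ {x} → Cᵢⱼ x → ¬ E x (v j)
  C⇒≁vⱼ ((_ , _ , x≁j) , _) = x≁j

  vm₀~C : ∀ {x} → Cᵢⱼ x → E (v m₀) x
  vm₀~C cx = E-sym (C⇒adjacent-below G v cx m₀<j m₀≢i)

  C⇒≁⇒≢m₀ : ∀ {x m} → Cᵢⱼ x → ¬ E x (v m) → m ≢ m₀
  C⇒≁⇒≢m₀ cx x≁m refl = x≁m (E-sym (vm₀~C cx))

  C⇒misses-other : ∀ {x} → Cᵢⱼ x → ∀ l → ∃[ t ] t ≢ l × ¬ E x (v t)
  C⇒misses-other cx l with l ≟ i
  ... | yes refl = j , ≢-sym (<⇒≢ i<j) , C⇒≁vⱼ cx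
  ... | no  l≢i  = i , ≢-sym l≢i , C⇒≁vᵢ cx

  C-P4Free : P4FreeOn G Cᵢⱼ
  C-P4Free = dominated⇒P4FreeOn G gem vm₀~C

  C-neighbourhood-closed : ∀ l → EdgeClosed G Cᵢⱼ (λ x → E x (v l))
  C-neighbourhood-closed l {a} {b} ca cb ab a~l with l ≟ m₀
  ... | yes refl = E-sym (vm₀~C cb)
  ... | no  l≢m₀ = GemFree⇒dominated-path-chord G gem ab a~l (v-cl l i l≢i)
    (C⇒≁vᵢ ca) (C⇒≁vᵢ cb) (C⇒∉A cb l) (C⇒∉A cb i) (C⇒∉A ca i)
    (vm₀~C ca) (vm₀~C cb) (v-cl m₀ l (≢-sym l≢m₀)) (v-cl m₀ i m₀≢i)
    where
    l≢i : l ≢ i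
    l≢i refl = C⇒≁vᵢ ca a~l

  component-neighbourhood : ∀ l {r a b} → Reach G Cᵢⱼ r a → Reach G Cᵢⱼ r b →
    E a (v l) → E b (v l)
  component-neighbourhood l ra rb =
    Reach-preserves G (C-neighbourhood-closed l) rb ∘ Reach-reflects G (C-neighbourhood-closed l) ra

  C-I-nonadjacent : ∀ l a → Cᵢⱼ a → ¬ E a (v l) → ∀ b → I G ω v l b → ¬ E a b
  C-I-nonadjacent l a ca a≁l b (b∉A , b~A) ab with C⇒misses-other ca l
  ... | t , t≢l , a≁t = a≁t (GemFree⇒dominated-path-chord G gem
    (E-sym ab) (b~A t t≢l) (v-cl t l t≢l) (adjacent-all-but⇒≁ b~A) a≁l
    (C⇒∉A ca t) (C⇒∉A ca l) (b∉A l)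
    (E-sym (b~A m₀ (≢-sym l≢m₀))) (vm₀~C ca)
    (v-cl m₀ t (≢-sym (C⇒≁⇒≢m₀ ca a≁t))) (v-cl m₀ l (≢-sym l≢m₀)))
    where
    l≢m₀ : l ≢ m₀
    l≢m₀ = C⇒≁⇒≢m₀ ca a≁l

  component-clique-bound : ∀ r (S : Subset ω) →
    (∀ m → m ∈ S ⇔ (¬ (∃[ b ] (Reach G Cᵢⱼ r b × E b (v m))))) →
    CliqueNumberOn≤ G (Reach G Cᵢⱼ r) ∣ S ∣
  component-clique-bound r S S⇔ k f f-cl f∈H = begin
    k          ≤⟨ m+n≤o⇒m≤o∸n k (clique+common-neighbours≤ω T f-cl f~T) ⟩
    ω ∸ ∣ T ∣  ≡⟨ ∣∁p∣≡n∸∣p∣ T ⟨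
    ∣ ∁ T ∣    ≤⟨ p⊆q⇒∣p∣≤∣q∣ ∁T⊆S ⟩
    ∣ S ∣      ∎
    where
    open ≤-Reasoning
    r~? : Decidable (λ m → E r (v m))
    r~? m = E? r (v m)
    T : Subset ω
    T = subset r~?
    f~T : ∀ a m → m ∈ T → E (f a) (v m)
    f~T a m m∈T = Reach-preserves G (C-neighbourhood-closed m) (f∈H a) (∈-subset⁻ r~? m∈T)
    ∁T⊆S : ∁ T ⊆ S
    ∁T⊆S {m} m∉T = Equivalence.from (S⇔ m) λ (b , rb , b~m) →
      x∈∁p⇒x∉p m∉T (∈-subset⁺ r~? (Reach-reflects G (C-neighbourhood-closed m) rb b~m))

lemma2p3 : (G : Graph) → GemFree G →
    (ω : ℕ) → (v : Fin ω → Fin (Graph.n G)) →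
    IsClique G ω v →
    (∀ k (f : Fin k → Fin (Graph.n G)) → IsClique G k f → k ≤ ω) →
    (i j : Fin ω) → i < j → 2 ≤ toℕ j →
    P4FreeOn G (C G ω v i j)
    × (∀ l r → C G ω v i j r → ∀ a → Reach G (C G ω v i j) r a →
         Graph.E G a (v l) →
         ∀ b → Reach G (C G ω v i j) r b → Graph.E G b (v l))
    × (∀ l a → C G ω v i j a → ¬ Graph.E G a (v l) →
         ∀ b → I G ω v l b → ¬ Graph.E G a b)
    × (∀ r → C G ω v i j r → ∀ (S : Subset ω) →
         (∀ m → m ∈ S ⇔ (¬ (∃[ b ] (Reach G (C G ω v i j) r b × Graph.E G b (v m))))) →
         CliqueNumberOn≤ G (Reach G (C G ω v i j) r) ∣ S ∣)
lemma2p3 G gem ω v v-cl maximum i j i<j 2≤j with ∃<≢ i j 2≤j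
... | m₀ , m₀<j , m₀≢i =
  C-P4Free ,
  (λ l r _ a ra a~l b rb → component-neighbourhood l ra rb a~l) ,
  C-I-nonadjacent ,
  (λ r _ → component-clique-bound r)
  where open C-Properties G gem v-cl maximum i<j m₀<j m₀≢i
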